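{- Let $L$ be a nonnegative integer and let $q,z$ be indeterminates. Then \[ \sum_{n=0}^{L}\left\{\frac{(-1)^n q^{(n+1)(L-n)}+z^{n+1}}{q^{L-n}+z}+\frac{(-1)^{n+1}q^{n(L-n)}+z^{ -n}}{1+zq^{L-n}}\right\}q^{T_n} =\sum_{i,j,k\ge 0}(-1)^k z^{i-j}q^{T_i+T_j+T_k-\min(i,j)}\begin{bmatrix}L-k\\ i\end{bmatrix}\begin{bmatrix}L-j\\ k\end{bmatrix}\begin{bmatrix}L-i\\ j\end{bmatrix}. \]
   Context: For an integer $n$, $T_n=n(n+1)/2$. For a nonnegative integer $n$, $(a;q)_n=\prod_{k=0}^{n-1}(1-aq^k)$. For integers $n,k$, the $q$-binomial coefficient is $\begin{bmatrix}n\\ k\end{bmatrix}=\frac{(q;q)_n}{(q;q)_k(q;q)_{n-k}}$ if $0\le k\le n$ and $0$ otherwise. The identity is an identity of rational functions in $q,z$. -}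

module Defs where

open import Data.Nat as ℕ using (ℕ; zero; suc; _∸_; _≤ᵇ_)
open import Data.Nat.Base using (_⊓_)
open import Data.Bool using (if_then_else_)
open import Data.Rational using (ℚ; 0ℚ; 1ℚ; _+_; _*_; -_; _÷_; ≢-nonZero)
open import Data.Rational.Properties using (_≟_)
open import Relation.Nullary using (yes; no)

_^_ : ℚ → ℕ → ℚ
x ^ zero  = 1ℚ
x ^ suc n = x * (x ^ n)

infixr 8 _^_

-- total division (x / 0 := 0); all uses in the statement have nonzero
-- denominators under the hypotheses
_⊘_ : ℚ → ℚ → ℚ
x ⊘ y with y ≟ 0ℚ
... | yes _ = 0ℚ
... | no y≢0 = _÷_ x y {{≢-nonZero y≢0}}

infixl 7 _⊘_

zpow : ℚ → ℕ → ℕ → ℚ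
zpow z i j = if j ≤ᵇ i then z ^ (i ∸ j) else (1ℚ ⊘ (z ^ (j ∸ i)))

sgn : ℕ → ℚ
sgn n = (- 1ℚ) ^ n

T : ℕ → ℕ
T zero    = zero
T (suc n) = suc n ℕ.+ T n

poch : ℚ → ℚ → ℕ → ℚ
poch a q zero    = 1ℚ
poch a q (suc n) = poch a q n * (1ℚ + - (a * q ^ n))

qbin : ℚ → ℕ → ℕ → ℚ
qbin q n k = if k ≤ᵇ n
  then poch q q n ⊘ (poch q q k * poch q q (n ∸ k))
  else 0ℚ

sumTo : ℕ → (ℕ → ℚ) → ℚ
sumTo zero    f = f 0
sumTo (suc L) f = sumTo L f + f (suc L)

lhsTerm : ℚ → ℚ → ℕ → ℕ → ℚ
lhsTerm q z L n =
  ( (sgn n * q ^ (suc n ℕ.* (L ∸ n)) + z ^ suc n) ⊘ (q ^ (L ∸ n) + z)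
  + (sgn (suc n) * q ^ (n ℕ.* (L ∸ n)) + zpow z 0 n) ⊘ (1ℚ + z * q ^ (L ∸ n)) )
  * q ^ T n

rhsTerm : ℚ → ℚ → ℕ → ℕ → ℕ → ℕ → ℚ
rhsTerm q z L i j k =
  sgn k * zpow z i j * q ^ ((T i ℕ.+ T j ℕ.+ T k) ∸ (i ⊓ j))
  * qbin q (L ∸ k) i * qbin q (L ∸ j) k * qbin q (L ∸ i) j

{-# OPTIONS --safe #-}
-- Both sides, as functions F of L, satisfy F 0 = 1 and
--   F (L + 1) + q^(L+1) F L = Σ_{|k| ≤ L+1} z^k q^(T_|k|),
-- so they agree.  On the left each fraction is a finite geometric sum, and the
-- recurrence holds termwise under (L, n) ↦ (L + 1, n + 1).  On the right,
-- T_i + T_j + T_k - min(i, j) = ij + T_|i-j| + T_k, and the alternating sum over k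
-- collapses to [L-j, i] (q;q)_(L-i-j); what remains is Σ_{i,j} z^(i-j) q^(T_|i-j|) W_L(i, j)
-- with weights obeying W_(L+1)(i, j) = (1 - q^(L+1)) W_L(i, j) + q^L W_(L-1)(i-1, j-1)
-- except at the corners (0, L+1) and (L+1, 0), which supply the new terms z^(±(L+1)) q^(T_(L+1)).
-- A rational q ≠ ±1 is not a root of unity, so (q;q)_n ≠ 0 and the q-binomials of the
-- statement are the polynomial ones given by the q-Pascal rule.
module Submission where

open import Data.Bool.Base using (true; false)
open import Data.Empty using (⊥-elim)
open import Data.Nat.Base as ℕ using (ℕ; zero; suc; _∸_; _⊓_; _≤_; _<_; z≤n; s≤s)
import Data.Nat.Properties as ℕ
open import Data.Nat.Properties using (_≤?_)
open import Data.Nat.Tactic.RingSolver using () renaming (solve-∀ to ℕ-solve)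
open import Data.Product.Base using (Σ; _,_)
open import Data.Rational.Base using (ℚ; 0ℚ; 1ℚ; _+_; _*_; -_; _-_; 1/_; ∣_∣; ≢-nonZero; nonNegative)
  renaming (_≤_ to _≤ℚ_)
import Data.Rational.Properties as ℚ
open import Algebra.Properties.Group ℚ.+-0-group using ()
  renaming (∙-cancelʳ to +-cancelʳ; inverseˡ-unique to -‿inverseˡ-unique; ⁻¹-involutive to -‿involutive)
open import Data.Sum.Base using (inj₁; inj₂; [_,_])
open import Function.Base using (_∘_)
open import Level using (0ℓ)
open import Relation.Binary.Definitions using (tri<; tri≈; tri>)
open import Relation.Binary.PropositionalEquality
  using (_≡_; _≢_; refl; sym; trans; cong; cong₂; subst; module ≡-Reasoning)
open import Relation.Nullary using (yes; no)
open import Relation.Nullary.Decidable.Core using (dec⇒maybe)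
open import Relation.Nullary.Reflects using (ofʸ; ofⁿ)
open import Tactic.RingSolver using (solve-∀)
import Tactic.RingSolver.Core.AlmostCommutativeRing as ACR

open import Defs

open ≡-Reasoning

ℚ-ring : ACR.AlmostCommutativeRing 0ℓ 0ℓ
ℚ-ring = ACR.fromCommutativeRing ℚ.+-*-commutativeRing (λ x → dec⇒maybe (0ℚ ℚ.≟ x))

*-cancelʳ-≡ : ∀ {a b} c → c ≢ 0ℚ → a * c ≡ b * c → a ≡ b
*-cancelʳ-≡ {a} {b} c c≢0 ac≡bc = begin
  a              ≡⟨ cancel a ⟨
  a * c * 1/ c   ≡⟨ cong (_* 1/ c) ac≡bc ⟩
  b * c * 1/ c   ≡⟨ cancel b ⟩
  b              ∎
  where
  instance _ = ≢-nonZero c≢0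
  cancel : ∀ x → x * c * 1/ c ≡ x
  cancel x = trans (ℚ.*-assoc x c (1/ c)) (trans (cong (x *_) (ℚ.*-inverseʳ c)) (ℚ.*-identityʳ x))

*-≢0 : ∀ {x y} → x ≢ 0ℚ → y ≢ 0ℚ → x * y ≢ 0ℚ
*-≢0 {x} {y} x≢0 y≢0 xy≡0 = y≢0 (*-cancelʳ-≡ x x≢0 (trans (ℚ.*-comm y x) (trans xy≡0 (sym (ℚ.*-zeroˡ x)))))

⊘-*-cancelʳ : ∀ x {y} → y ≢ 0ℚ → (x ⊘ y) * y ≡ x
⊘-*-cancelʳ x {y} y≢0 with y ℚ.≟ 0ℚ
... | yes y≡0  = ⊥-elim (y≢0 y≡0)
... | no  y≢0′ = trans (ℚ.*-assoc x (1/ y) y) (trans (cong (x *_) (ℚ.*-inverseˡ y)) (ℚ.*-identityʳ x))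
  where instance _ = ≢-nonZero y≢0′

⊘-unique : ∀ {x y w} → y ≢ 0ℚ → w * y ≡ x → x ⊘ y ≡ w
⊘-unique {x} {y} y≢0 wy≡x = *-cancelʳ-≡ y y≢0 (trans (⊘-*-cancelʳ x y≢0) (sym wy≡x))

^-distribˡ-+-* : ∀ x m n → x ^ (m ℕ.+ n) ≡ x ^ m * x ^ n
^-distribˡ-+-* x zero    n = sym (ℚ.*-identityˡ (x ^ n))
^-distribˡ-+-* x (suc m) n = trans (cong (x *_) (^-distribˡ-+-* x m n)) (sym (ℚ.*-assoc x (x ^ m) (x ^ n)))

^-*-assoc : ∀ x m n → (x ^ m) ^ n ≡ x ^ (m ℕ.* n)
^-*-assoc x m zero    = cong (x ^_) (sym (ℕ.*-zeroʳ m))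
^-*-assoc x m (suc n) = begin
  x ^ m * (x ^ m) ^ n      ≡⟨ cong (x ^ m *_) (^-*-assoc x m n) ⟩
  x ^ m * x ^ (m ℕ.* n)    ≡⟨ ^-distribˡ-+-* x m (m ℕ.* n) ⟨
  x ^ (m ℕ.+ m ℕ.* n)      ≡⟨ cong (x ^_) (sym (ℕ.*-suc m n)) ⟩
  x ^ (m ℕ.* suc n)        ∎

^-distribʳ-* : ∀ x y n → (x * y) ^ n ≡ x ^ n * y ^ n
^-distribʳ-* x y zero    = refl
^-distribʳ-* x y (suc n) = trans (cong (x * y *_) (^-distribʳ-* x y n)) (interchange x y (x ^ n) (y ^ n))
  where
  interchange : ∀ a b c d → a * b * (c * d) ≡ a * c * (b * d)
  interchange = solve-∀ ℚ-ring

1^n≡1 : ∀ n → 1ℚ ^ n ≡ 1ℚ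
1^n≡1 zero    = refl
1^n≡1 (suc n) = trans (ℚ.*-identityˡ (1ℚ ^ n)) (1^n≡1 n)

neg-^ : ∀ x n → (- x) ^ n ≡ sgn n * x ^ n
neg-^ x n = trans (cong (_^ n) (neg≡-1* x)) (^-distribʳ-* (- 1ℚ) x n)
  where
  neg≡-1* : ∀ x → - x ≡ - 1ℚ * x
  neg≡-1* = solve-∀ ℚ-ring

^-≢0 : ∀ {x} n → x ≢ 0ℚ → x ^ n ≢ 0ℚ
^-≢0 zero    x≢0 ()
^-≢0 (suc n) x≢0 = *-≢0 x≢0 (^-≢0 n x≢0)

∣^∣ : ∀ x n → ∣ x ^ n ∣ ≡ ∣ x ∣ ^ n
∣^∣ x zero    = refl
∣^∣ x (suc n) = trans (ℚ.∣p*q∣≡∣p∣*∣q∣ x (x ^ n)) (cong (∣ x ∣ *_) (∣^∣ x n))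

module _ {s : ℚ} (0≤s : 0ℚ ≤ℚ s) where
  private instance _ = nonNegative 0≤s

  ^-≤1 : s ≤ℚ 1ℚ → ∀ n → s ^ n ≤ℚ 1ℚ
  ^-≤1 s≤1 zero    = ℚ.≤-refl
  ^-≤1 s≤1 (suc n) =
    ℚ.≤-trans (ℚ.*-monoˡ-≤-nonNeg s (^-≤1 s≤1 n)) (ℚ.≤-trans (ℚ.≤-reflexive (ℚ.*-identityʳ s)) s≤1)

  1≤^ : 1ℚ ≤ℚ s → ∀ n → 1ℚ ≤ℚ s ^ n
  1≤^ 1≤s zero    = ℚ.≤-refl
  1≤^ 1≤s (suc n) =
    ℚ.≤-trans 1≤s (ℚ.≤-trans (ℚ.≤-reflexive (sym (ℚ.*-identityʳ s))) (ℚ.*-monoˡ-≤-nonNeg s (1≤^ 1≤s n)))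

  ^-suc≡1⇒≡1 : ∀ n → s ^ suc n ≡ 1ℚ → s ≡ 1ℚ
  ^-suc≡1⇒≡1 n sⁿ⁺¹≡1 with ℚ.<-cmp s 1ℚ
  ... | tri≈ _ s≡1 _ = s≡1
  ... | tri< s<1 _ _ = ⊥-elim (ℚ.<-irrefl sⁿ⁺¹≡1 (ℚ.≤-<-trans sⁿ⁺¹≤s s<1))
    where
    sⁿ⁺¹≤s : s ^ suc n ≤ℚ s
    sⁿ⁺¹≤s = ℚ.≤-trans (ℚ.*-monoˡ-≤-nonNeg s (^-≤1 (ℚ.<⇒≤ s<1) n)) (ℚ.≤-reflexive (ℚ.*-identityʳ s))
  ... | tri> _ _ s>1 = ⊥-elim (ℚ.<-irrefl (sym sⁿ⁺¹≡1) (ℚ.<-≤-trans s>1 s≤sⁿ⁺¹))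
    where
    s≤sⁿ⁺¹ : s ≤ℚ s ^ suc n
    s≤sⁿ⁺¹ = ℚ.≤-trans (ℚ.≤-reflexive (sym (ℚ.*-identityʳ s))) (ℚ.*-monoˡ-≤-nonNeg s (1≤^ (ℚ.<⇒≤ s>1) n))

^-suc≢1 : ∀ {q} → q ≢ 1ℚ → q ≢ - 1ℚ → ∀ n → q ^ suc n ≢ 1ℚ
^-suc≢1 {q} q≢1 q≢-1 n qⁿ⁺¹≡1 =
  [ (λ ∣q∣≡q → q≢1 (trans (sym ∣q∣≡q) ∣q∣≡1))
  , (λ ∣q∣≡-q → q≢-1 (ℚ.neg-injective (trans (sym ∣q∣≡-q) ∣q∣≡1)))
  ]
    (ℚ.∣p∣≡p∨∣p∣≡-p q)
  where
  ∣q∣≡1 : ∣ q ∣ ≡ 1ℚ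
  ∣q∣≡1 = ^-suc≡1⇒≡1 (ℚ.0≤∣p∣ q) n (trans (sym (∣^∣ q (suc n))) (cong ∣_∣ qⁿ⁺¹≡1))

geom : ℚ → ℚ → ℕ → ℚ
geom x y zero    = 0ℚ
geom x y (suc n) = x ^ n + y * geom x y n

geom-* : ∀ x y n → (x - y) * geom x y n ≡ x ^ n - y ^ n
geom-* x y zero    = empty x y
  where
  empty : ∀ x y → (x - y) * 0ℚ ≡ 1ℚ - 1ℚ
  empty = solve-∀ ℚ-ring
geom-* x y (suc n) = begin
  (x - y) * (x ^ n + y * geom x y n)        ≡⟨ distrib x y (x ^ n) (geom x y n) ⟩
  (x - y) * x ^ n + y * ((x - y) * geom x y n) ≡⟨ cong (λ t → (x - y) * x ^ n + y * t) (geom-* x y n) ⟩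
  (x - y) * x ^ n + y * (x ^ n - y ^ n)     ≡⟨ telescope x y (x ^ n) (y ^ n) ⟩
  x * x ^ n - y * y ^ n                     ∎
  where
  distrib : ∀ x y a G → (x - y) * (a + y * G) ≡ (x - y) * a + y * ((x - y) * G)
  distrib = solve-∀ ℚ-ring
  telescope : ∀ x y a b → (x - y) * a + y * (a - b) ≡ x * a - y * b
  telescope = solve-∀ ℚ-ring

m+n+o∸m≡n+o : ∀ m n o → m ℕ.+ n ℕ.+ o ∸ m ≡ n ℕ.+ o
m+n+o∸m≡n+o m n o = trans (cong (_∸ m) (ℕ.+-assoc m n o)) (ℕ.m+n∸m≡n m (n ℕ.+ o))

m+n+o∸n≡m+o : ∀ m n o → m ℕ.+ n ℕ.+ o ∸ n ≡ m ℕ.+ o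
m+n+o∸n≡m+o m n o = trans (cong (_∸ n) (rearrange m n o)) (ℕ.m+n∸m≡n n (m ℕ.+ o))
  where
  rearrange : ∀ m n o → m ℕ.+ n ℕ.+ o ≡ n ℕ.+ (m ℕ.+ o)
  rearrange = ℕ-solve

m∸n∸o≡m∸o∸n : ∀ m n o → m ∸ n ∸ o ≡ m ∸ o ∸ n
m∸n∸o≡m∸o∸n m n o = trans (ℕ.∸-+-assoc m n o) (trans (cong (m ∸_) (ℕ.+-comm n o)) (sym (ℕ.∸-+-assoc m o n)))

T+T : ∀ i j → T i ℕ.+ T j ≡ i ℕ.* j ℕ.+ T ℕ.∣ i - j ∣ ℕ.+ i ⊓ j
T+T zero    j       = sym (ℕ.+-identityʳ (T j))
T+T (suc i) zero    rewrite ℕ.*-zeroʳ i = refl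
T+T (suc i) (suc j) = begin
  (suc i ℕ.+ T i) ℕ.+ (suc j ℕ.+ T j)                       ≡⟨ split i j (T i) (T j) ⟩
  2 ℕ.+ i ℕ.+ j ℕ.+ (T i ℕ.+ T j)                            ≡⟨ cong (2 ℕ.+ i ℕ.+ j ℕ.+_) (T+T i j) ⟩
  2 ℕ.+ i ℕ.+ j ℕ.+ (i ℕ.* j ℕ.+ T ℕ.∣ i - j ∣ ℕ.+ i ⊓ j)      ≡⟨ merge i j (T ℕ.∣ i - j ∣) (i ⊓ j) ⟩
  suc i ℕ.* suc j ℕ.+ T ℕ.∣ i - j ∣ ℕ.+ suc (i ⊓ j)            ∎
  where
  split : ∀ i j a b → (suc i ℕ.+ a) ℕ.+ (suc j ℕ.+ b) ≡ 2 ℕ.+ i ℕ.+ j ℕ.+ (a ℕ.+ b)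
  split = ℕ-solve
  merge : ∀ i j t m → 2 ℕ.+ i ℕ.+ j ℕ.+ (i ℕ.* j ℕ.+ t ℕ.+ m) ≡ suc i ℕ.* suc j ℕ.+ t ℕ.+ suc m
  merge = ℕ-solve

T-exponent : ∀ i j k → T i ℕ.+ T j ℕ.+ T k ∸ i ⊓ j ≡ i ℕ.* j ℕ.+ T ℕ.∣ i - j ∣ ℕ.+ T k
T-exponent i j k = begin
  T i ℕ.+ T j ℕ.+ T k ∸ i ⊓ j                          ≡⟨ cong (λ t → t ℕ.+ T k ∸ i ⊓ j) (T+T i j) ⟩
  i ℕ.* j ℕ.+ T ℕ.∣ i - j ∣ ℕ.+ i ⊓ j ℕ.+ T k ∸ i ⊓ j    ≡⟨ cong (_∸ i ⊓ j) (swap (i ℕ.* j ℕ.+ T ℕ.∣ i - j ∣) (i ⊓ j) (T k)) ⟩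
  i ℕ.* j ℕ.+ T ℕ.∣ i - j ∣ ℕ.+ T k ℕ.+ i ⊓ j ∸ i ⊓ j    ≡⟨ ℕ.m+n∸n≡m _ (i ⊓ j) ⟩
  i ℕ.* j ℕ.+ T ℕ.∣ i - j ∣ ℕ.+ T k                      ∎
  where
  swap : ∀ a m t → a ℕ.+ m ℕ.+ t ≡ a ℕ.+ t ℕ.+ m
  swap = ℕ-solve

sumTo-cong≤ : ∀ n {f g : ℕ → ℚ} → (∀ k → k ≤ n → f k ≡ g k) → sumTo n f ≡ sumTo n g
sumTo-cong≤ zero    f≗g = f≗g 0 z≤n
sumTo-cong≤ (suc n) f≗g =
  cong₂ _+_ (sumTo-cong≤ n (λ k k≤n → f≗g k (ℕ.m≤n⇒m≤1+n k≤n))) (f≗g (suc n) ℕ.≤-refl)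

sumTo-cong : ∀ n {f g : ℕ → ℚ} → (∀ k → f k ≡ g k) → sumTo n f ≡ sumTo n g
sumTo-cong n f≗g = sumTo-cong≤ n (λ k _ → f≗g k)

sumTo-zero : ∀ n {f : ℕ → ℚ} → (∀ k → k ≤ n → f k ≡ 0ℚ) → sumTo n f ≡ 0ℚ
sumTo-zero zero    f≗0 = f≗0 0 z≤n
sumTo-zero (suc n) f≗0 =
  cong₂ _+_ (sumTo-zero n (λ k k≤n → f≗0 k (ℕ.m≤n⇒m≤1+n k≤n))) (f≗0 (suc n) ℕ.≤-refl)

sumTo-+ : ∀ n (f g : ℕ → ℚ) → sumTo n (λ k → f k + g k) ≡ sumTo n f + sumTo n g
sumTo-+ zero    f g = refl
sumTo-+ (suc n) f g = trans (cong (_+ (f (suc n) + g (suc n))) (sumTo-+ n f g))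
                            (interchange (sumTo n f) (sumTo n g) (f (suc n)) (g (suc n)))
  where
  interchange : ∀ a b c d → (a + b) + (c + d) ≡ (a + c) + (b + d)
  interchange = solve-∀ ℚ-ring

sumTo-*ˡ : ∀ n c (f : ℕ → ℚ) → sumTo n (λ k → c * f k) ≡ c * sumTo n f
sumTo-*ˡ zero    c f = refl
sumTo-*ˡ (suc n) c f = trans (cong (_+ c * f (suc n)) (sumTo-*ˡ n c f)) (sym (ℚ.*-distribˡ-+ c (sumTo n f) (f (suc n))))

sumTo-head : ∀ n (f : ℕ → ℚ) → sumTo (suc n) f ≡ f 0 + sumTo n (λ k → f (suc k))
sumTo-head zero    f = refl
sumTo-head (suc n) f = trans (cong (_+ f (suc (suc n))) (sumTo-head n f))
                             (ℚ.+-assoc (f 0) (sumTo n (λ k → f (suc k))) (f (suc (suc n))))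

sumTo-only-head : ∀ n (f : ℕ → ℚ) → (∀ k → f (suc k) ≡ 0ℚ) → sumTo n f ≡ f 0
sumTo-only-head zero    f tail≡0 = refl
sumTo-only-head (suc n) f tail≡0 = trans (cong₂ _+_ (sumTo-only-head n f tail≡0) (tail≡0 n)) (ℚ.+-identityʳ (f 0))

sumTo-drop-last : ∀ n (f : ℕ → ℚ) → f (suc n) ≡ 0ℚ → sumTo (suc n) f ≡ sumTo n f
sumTo-drop-last n f last≡0 = trans (cong (sumTo n f +_) last≡0) (ℚ.+-identityʳ (sumTo n f))

sumTo² : ℕ → (ℕ → ℕ → ℚ) → ℚ
sumTo² n f = sumTo n (λ i → sumTo n (f i))

sumTo²-cong≤ : ∀ n {f g : ℕ → ℕ → ℚ} → (∀ i j → i ≤ n → j ≤ n → f i j ≡ g i j) → sumTo² n f ≡ sumTo² n g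
sumTo²-cong≤ n f≗g = sumTo-cong≤ n (λ i i≤n → sumTo-cong≤ n (λ j j≤n → f≗g i j i≤n j≤n))

sumTo²-cong : ∀ n {f g : ℕ → ℕ → ℚ} → (∀ i j → f i j ≡ g i j) → sumTo² n f ≡ sumTo² n g
sumTo²-cong n f≗g = sumTo-cong n (λ i → sumTo-cong n (f≗g i))

sumTo²-+ : ∀ n (f g : ℕ → ℕ → ℚ) → sumTo² n (λ i j → f i j + g i j) ≡ sumTo² n f + sumTo² n g
sumTo²-+ n f g = trans (sumTo-cong n (λ i → sumTo-+ n (f i) (g i))) (sumTo-+ n _ _)

sumTo²-*ˡ : ∀ n c (f : ℕ → ℕ → ℚ) → sumTo² n (λ i j → c * f i j) ≡ c * sumTo² n f
sumTo²-*ˡ n c f = trans (sumTo-cong n (λ i → sumTo-*ˡ n c (f i))) (sumTo-*ˡ n c _)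

sumTo²-drop-last : ∀ n (f : ℕ → ℕ → ℚ) → (∀ j → f (suc n) j ≡ 0ℚ) → (∀ i → f i (suc n) ≡ 0ℚ) →
                   sumTo² (suc n) f ≡ sumTo² n f
sumTo²-drop-last n f lastRow≡0 lastColumn≡0 = begin
  sumTo n (λ i → sumTo (suc n) (f i)) + sumTo (suc n) (f (suc n))
    ≡⟨ cong₂ _+_ (sumTo-cong n (λ i → sumTo-drop-last n (f i) (lastColumn≡0 i)))
                 (sumTo-zero (suc n) (λ j _ → lastRow≡0 j)) ⟩
  sumTo² n f + 0ℚ
    ≡⟨ ℚ.+-identityʳ _ ⟩
  sumTo² n f ∎

sumTo²-drop-first : ∀ n (f : ℕ → ℕ → ℚ) → (∀ j → f 0 j ≡ 0ℚ) → (∀ i → f i 0 ≡ 0ℚ) →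
                    sumTo² (suc n) f ≡ sumTo² n (λ i j → f (suc i) (suc j))
sumTo²-drop-first n f firstRow≡0 firstColumn≡0 = begin
  sumTo (suc n) (λ i → sumTo (suc n) (f i))
    ≡⟨ sumTo-head n _ ⟩
  sumTo (suc n) (f 0) + sumTo n (λ i → sumTo (suc n) (f (suc i)))
    ≡⟨ cong₂ _+_ (sumTo-zero (suc n) (λ j _ → firstRow≡0 j)) (sumTo-cong n (λ i → sumTo-head n (f (suc i)))) ⟩
  0ℚ + sumTo n (λ i → f (suc i) 0 + sumTo n (λ j → f (suc i) (suc j)))
    ≡⟨ ℚ.+-identityˡ _ ⟩
  sumTo n (λ i → f (suc i) 0 + sumTo n (λ j → f (suc i) (suc j)))
    ≡⟨ sumTo-cong n (λ i → trans (cong (_+ sumTo n (λ j → f (suc i) (suc j))) (firstColumn≡0 (suc i))) (ℚ.+-identityˡ _)) ⟩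
  sumTo² n (λ i j → f (suc i) (suc j)) ∎

δ : ℕ → ℕ → ℚ
δ zero    zero    = 1ℚ
δ (suc m) (suc n) = δ m n
δ _       _       = 0ℚ

δ-refl : ∀ n → δ n n ≡ 1ℚ
δ-refl zero    = refl
δ-refl (suc n) = δ-refl n

δ-≢ : ∀ {m n} → m ≢ n → δ m n ≡ 0ℚ
δ-≢ {zero}  {zero}  0≢0 = ⊥-elim (0≢0 refl)
δ-≢ {zero}  {suc n} _   = refl
δ-≢ {suc m} {zero}  _   = refl
δ-≢ {suc m} {suc n} m≢n = δ-≢ (m≢n ∘ cong suc)

corner : ℕ → ℕ → ℕ → ℚ
corner L zero    j       = δ j L
corner L (suc i) zero    = δ (suc i) L
corner L (suc i) (suc j) = 0ℚ

sumTo-δ : ∀ n (f : ℕ → ℚ) → sumTo n (λ j → f j * δ j n) ≡ f n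
sumTo-δ zero    f = ℚ.*-identityʳ (f 0)
sumTo-δ (suc n) f = begin
  sumTo n (λ j → f j * δ j (suc n)) + f (suc n) * δ (suc n) (suc n)
    ≡⟨ cong₂ _+_ (sumTo-zero n (λ j j≤n →
                   trans (cong (f j *_) (δ-≢ {j} {suc n} (ℕ.<⇒≢ (s≤s j≤n)))) (ℚ.*-zeroʳ (f j))))
                 (cong (f (suc n) *_) (δ-refl (suc n))) ⟩
  0ℚ + f (suc n) * 1ℚ
    ≡⟨ trans (ℚ.+-identityˡ _) (ℚ.*-identityʳ _) ⟩
  f (suc n) ∎

-- theta q z L = Σ_{|k| ≤ L+1} z^k q^(T_|k|); zpow z 0 n is z^(-n).
thetaTerm : ℚ → ℚ → ℕ → ℚ
thetaTerm q z n = q ^ T n * (z ^ n + zpow z 0 n)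

theta : ℚ → ℚ → ℕ → ℚ
theta q z L = 1ℚ + sumTo L (λ n → thetaTerm q z (suc n))

first-order-unique : ∀ (a : ℕ → ℚ) {f g : ℕ → ℚ} → f 0 ≡ g 0 →
                     (∀ n → f (suc n) + a n * f n ≡ g (suc n) + a n * g n) → ∀ n → f n ≡ g n
first-order-unique a f₀≡g₀ step zero    = f₀≡g₀
first-order-unique a {f} {g} f₀≡g₀ step (suc n) = +-cancelʳ (a n * f n) (f (suc n)) (g (suc n)) (begin
  f (suc n) + a n * f n   ≡⟨ step n ⟩
  g (suc n) + a n * g n   ≡⟨ cong (λ t → g (suc n) + a n * t) (first-order-unique a {f} {g} f₀≡g₀ step n) ⟨
  g (suc n) + a n * f n   ∎)

module Gaussian (q : ℚ) where

  fac : ℕ → ℚ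
  fac = poch q q

  gauss : ℕ → ℕ → ℚ
  gauss n       zero    = 1ℚ
  gauss zero    (suc k) = 0ℚ
  gauss (suc n) (suc k) = gauss n k + q ^ suc k * gauss n (suc k)

  gauss-zero : ∀ {n k} → n < k → gauss n k ≡ 0ℚ
  gauss-zero {zero}  {suc k} _         = refl
  gauss-zero {suc n} {suc k} (s≤s n<k) = begin
    gauss n k + q ^ suc k * gauss n (suc k)
      ≡⟨ cong₂ (λ a b → a + q ^ suc k * b) (gauss-zero n<k) (gauss-zero (ℕ.m<n⇒m<1+n n<k)) ⟩
    0ℚ + q ^ suc k * 0ℚ
      ≡⟨ trans (ℚ.+-identityˡ _) (ℚ.*-zeroʳ (q ^ suc k)) ⟩
    0ℚ ∎

  gauss-zero-∸ : ∀ {n i j} → i ≤ n → n < i ℕ.+ j → gauss (n ∸ i) j ≡ 0ℚ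
  gauss-zero-∸ {n} {i} {j} i≤n n<i+j with ℕ.m≤n⇒∃[o]m+o≡n i≤n
  ... | r , refl rewrite ℕ.m+n∸m≡n i r = gauss-zero (ℕ.+-cancelˡ-< i r j n<i+j)

  gauss-diag : ∀ n → gauss n n ≡ 1ℚ
  gauss-diag zero    = refl
  gauss-diag (suc n) = begin
    gauss n n + q ^ suc n * gauss n (suc n)
      ≡⟨ cong₂ (λ a b → a + q ^ suc n * b) (gauss-diag n) (gauss-zero (ℕ.n<1+n n)) ⟩
    1ℚ + q ^ suc n * 0ℚ
      ≡⟨ trans (cong (1ℚ +_) (ℚ.*-zeroʳ (q ^ suc n))) (ℚ.+-identityʳ 1ℚ) ⟩
    1ℚ ∎

  gauss-suc-*-fac : ∀ k r → gauss (k ℕ.+ suc r) (suc k) * (fac (suc k) * fac r) ≡ fac (k ℕ.+ suc r)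

  gauss-*-fac : ∀ k r → gauss (k ℕ.+ r) k * (fac k * fac r) ≡ fac (k ℕ.+ r)
  gauss-*-fac zero    r       = trans (ℚ.*-identityˡ _) (ℚ.*-identityˡ _)
  gauss-*-fac (suc k) zero    = begin
    gauss (suc k ℕ.+ 0) (suc k) * (fac (suc k) * 1ℚ)
      ≡⟨ cong (λ n → gauss n (suc k) * (fac (suc k) * 1ℚ)) (ℕ.+-identityʳ (suc k)) ⟩
    gauss (suc k) (suc k) * (fac (suc k) * 1ℚ)
      ≡⟨ cong (_* (fac (suc k) * 1ℚ)) (gauss-diag (suc k)) ⟩
    1ℚ * (fac (suc k) * 1ℚ)
      ≡⟨ trans (ℚ.*-identityˡ _) (ℚ.*-identityʳ _) ⟩
    fac (suc k)
      ≡⟨ cong fac (ℕ.+-identityʳ (suc k)) ⟨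
    fac (suc k ℕ.+ 0) ∎
  gauss-*-fac (suc k) (suc r) = begin
    (A + x * B) * (fac k * (1ℚ - x) * (fac r * (1ℚ - y)))
      ≡⟨ split A B (fac k) (fac r) x y ⟩
    A * (fac k * fac (suc r)) * (1ℚ - x) + x * (B * (fac (suc k) * fac r)) * (1ℚ - y)
      ≡⟨ cong₂ (λ a b → a * (1ℚ - x) + x * b * (1ℚ - y)) (gauss-*-fac k (suc r)) (gauss-suc-*-fac k r) ⟩
    F * (1ℚ - x) + x * F * (1ℚ - y)
      ≡⟨ telescope F x y ⟩
    F * (1ℚ - x * y)
      ≡⟨ cong (λ t → F * (1ℚ - t)) (^-distribˡ-+-* q (suc k) (suc r)) ⟨
    fac (suc k ℕ.+ suc r) ∎
    where
    A = gauss (k ℕ.+ suc r) k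
    B = gauss (k ℕ.+ suc r) (suc k)
    F = fac (k ℕ.+ suc r)
    x = q ^ suc k
    y = q ^ suc r
    split : ∀ A B P R x y → (A + x * B) * (P * (1ℚ - x) * (R * (1ℚ - y)))
                          ≡ A * (P * (R * (1ℚ - y))) * (1ℚ - x) + x * (B * (P * (1ℚ - x) * R)) * (1ℚ - y)
    split = solve-∀ ℚ-ring
    telescope : ∀ F x y → F * (1ℚ - x) + x * F * (1ℚ - y) ≡ F * (1ℚ - x * y)
    telescope = solve-∀ ℚ-ring

  gauss-suc-*-fac k r =
    subst (λ n → gauss n (suc k) * (fac (suc k) * fac r) ≡ fac n) (sym (ℕ.+-suc k r)) (gauss-*-fac (suc k) r)

  fac-+-suc : ∀ m r → fac (m ℕ.+ suc r) ≡ fac (m ℕ.+ r) * (1ℚ - q ^ m * q ^ suc r)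
  fac-+-suc m r = begin
    fac (m ℕ.+ suc r)                                   ≡⟨ cong fac (ℕ.+-suc m r) ⟩
    fac (m ℕ.+ r) * (1ℚ - q ^ suc (m ℕ.+ r))            ≡⟨ cong (λ n → fac (m ℕ.+ r) * (1ℚ - q ^ n)) (ℕ.+-suc m r) ⟨
    fac (m ℕ.+ r) * (1ℚ - q ^ (m ℕ.+ suc r))            ≡⟨ cong (λ t → fac (m ℕ.+ r) * (1ℚ - t)) (^-distribˡ-+-* q m (suc r)) ⟩
    fac (m ℕ.+ r) * (1ℚ - q ^ m * q ^ suc r)            ∎

  gauss-*-fac-∸ : ∀ {n k} → k ≤ n → gauss n k * (fac k * fac (n ∸ k)) ≡ fac n
  gauss-*-fac-∸ {n} {k} k≤n =
    subst (λ m → gauss m k * (fac k * fac (n ∸ k)) ≡ fac m) (ℕ.m+[n∸m]≡n k≤n) (gauss-*-fac k (n ∸ k))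

  module _ (qⁿ≢1 : ∀ n → q ^ suc n ≢ 1ℚ) where

    fac≢0 : ∀ n → fac n ≢ 0ℚ
    fac≢0 zero    ()
    fac≢0 (suc n) = *-≢0 (fac≢0 n) λ 1-qⁿ⁺¹≡0 →
      qⁿ≢1 n (sym (trans (-‿inverseˡ-unique 1ℚ _ 1-qⁿ⁺¹≡0) (-‿involutive _)))

    qbin≡gauss : ∀ n k → qbin q n k ≡ gauss n k
    qbin≡gauss n k with k ℕ.≤ᵇ n | ℕ.≤ᵇ-reflects-≤ k n
    ... | true  | ofʸ k≤n = ⊘-unique (*-≢0 (fac≢0 k) (fac≢0 (n ∸ k))) (gauss-*-fac-∸ k≤n)
    ... | false | ofⁿ k≰n = sym (gauss-zero (ℕ.≰⇒> k≰n))

    gauss-pascalʳ : ∀ k r → gauss (suc (k ℕ.+ r)) (suc k) ≡ q ^ r * gauss (k ℕ.+ r) k + gauss (k ℕ.+ r) (suc k)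
    gauss-pascalʳ k r = *-cancelʳ-≡ (fac (suc k) * fac r) (*-≢0 (fac≢0 (suc k)) (fac≢0 r))
                              (trans (gauss-*-fac (suc k) r) (sym (rhs r)))
      where
      rhs : ∀ r → (q ^ r * gauss (k ℕ.+ r) k + gauss (k ℕ.+ r) (suc k)) * (fac (suc k) * fac r) ≡ fac (suc k ℕ.+ r)
      rhs zero rewrite ℕ.+-identityʳ k = begin
        (1ℚ * gauss k k + gauss k (suc k)) * (fac (suc k) * 1ℚ)
          ≡⟨ cong₂ (λ a b → (1ℚ * a + b) * (fac (suc k) * 1ℚ)) (gauss-diag k) (gauss-zero (ℕ.n<1+n k)) ⟩
        (1ℚ * 1ℚ + 0ℚ) * (fac (suc k) * 1ℚ)
          ≡⟨ unit (fac (suc k)) ⟩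
        fac (suc k) ∎
        where
        unit : ∀ P → (1ℚ * 1ℚ + 0ℚ) * (P * 1ℚ) ≡ P
        unit = solve-∀ ℚ-ring
      rhs (suc r) = begin
        (y * A + B) * (fac k * (1ℚ - x) * (fac r * (1ℚ - y)))
          ≡⟨ split A B (fac k) (fac r) x y ⟩
        y * (A * (fac k * fac (suc r))) * (1ℚ - x) + B * (fac (suc k) * fac r) * (1ℚ - y)
          ≡⟨ cong₂ (λ a b → y * a * (1ℚ - x) + b * (1ℚ - y)) (gauss-*-fac k (suc r)) (gauss-suc-*-fac k r) ⟩
        y * F * (1ℚ - x) + F * (1ℚ - y)
          ≡⟨ telescope F x y ⟩
        F * (1ℚ - x * y)
          ≡⟨ cong (λ t → F * (1ℚ - t)) (^-distribˡ-+-* q (suc k) (suc r)) ⟨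
        fac (suc k ℕ.+ suc r) ∎
        where
        A = gauss (k ℕ.+ suc r) k
        B = gauss (k ℕ.+ suc r) (suc k)
        F = fac (k ℕ.+ suc r)
        x = q ^ suc k
        y = q ^ suc r
        split : ∀ A B P R x y → (y * A + B) * (P * (1ℚ - x) * (R * (1ℚ - y)))
                              ≡ y * (A * (P * (R * (1ℚ - y)))) * (1ℚ - x) + B * (P * (1ℚ - x) * R) * (1ℚ - y)
        split = solve-∀ ℚ-ring
        telescope : ∀ F x y → y * F * (1ℚ - x) + F * (1ℚ - y) ≡ F * (1ℚ - x * y)
        telescope = solve-∀ ℚ-ring

    gauss-pascalʳ-scaled : ∀ N k → q ^ suc k * gauss (suc N) (suc k) ≡ q ^ suc N * gauss N k + q ^ suc k * gauss N (suc k)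
    gauss-pascalʳ-scaled N k with k ≤? N
    ... | yes k≤N = scaled (ℕ.m≤n⇒∃[o]m+o≡n k≤N)
      where
      scaled : Σ ℕ (λ r → k ℕ.+ r ≡ N) → q ^ suc k * gauss (suc N) (suc k) ≡ q ^ suc N * gauss N k + q ^ suc k * gauss N (suc k)
      scaled (r , refl) = begin
        q ^ suc k * gauss (suc (k ℕ.+ r)) (suc k)
          ≡⟨ cong (q ^ suc k *_) (gauss-pascalʳ k r) ⟩
        q ^ suc k * (q ^ r * gauss (k ℕ.+ r) k + gauss (k ℕ.+ r) (suc k))
          ≡⟨ distrib (q ^ suc k) (q ^ r) _ _ ⟩
        q ^ suc k * q ^ r * gauss (k ℕ.+ r) k + q ^ suc k * gauss (k ℕ.+ r) (suc k)
          ≡⟨ cong (λ t → t * gauss (k ℕ.+ r) k + q ^ suc k * gauss (k ℕ.+ r) (suc k)) (^-distribˡ-+-* q (suc k) r) ⟨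
        q ^ suc (k ℕ.+ r) * gauss (k ℕ.+ r) k + q ^ suc k * gauss (k ℕ.+ r) (suc k) ∎
        where
        distrib : ∀ x y a b → x * (y * a + b) ≡ x * y * a + x * b
        distrib = solve-∀ ℚ-ring
    ... | no  k≰N = begin
      q ^ suc k * gauss (suc N) (suc k)
        ≡⟨ cong (q ^ suc k *_) (gauss-zero (s≤s N<k)) ⟩
      q ^ suc k * 0ℚ
        ≡⟨ vanish (q ^ suc N) (q ^ suc k) ⟩
      q ^ suc N * 0ℚ + q ^ suc k * 0ℚ
        ≡⟨ cong₂ (λ a b → q ^ suc N * a + q ^ suc k * b) (gauss-zero N<k) (gauss-zero (ℕ.m<n⇒m<1+n N<k)) ⟨
      q ^ suc N * gauss N k + q ^ suc k * gauss N (suc k) ∎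
      where
      N<k = ℕ.≰⇒> k≰N
      vanish : ∀ x y → y * 0ℚ ≡ x * 0ℚ + y * 0ℚ
      vanish = solve-∀ ℚ-ring

module AlternatingSum (q : ℚ) where
  open Gaussian q

  altTerm : ℕ → ℕ → ℕ → ℕ → ℚ
  altTerm N M i k = sgn k * q ^ T k * (gauss N k * gauss (M ∸ k) i)

  alt : ℕ → ℕ → ℕ → ℚ
  alt N M i = sumTo M (altTerm N M i)

  alt-stepᵢ : ∀ N M i → alt N (suc M) (suc i) ≡ alt N M i + q ^ suc i * alt N M (suc i)
  alt-stepᵢ N M i = begin
    alt N (suc M) (suc i)
      ≡⟨ sumTo-drop-last M (altTerm N (suc M) (suc i)) last≡0 ⟩
    sumTo M (altTerm N (suc M) (suc i))
      ≡⟨ sumTo-cong≤ M pascal ⟩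
    sumTo M (λ k → altTerm N M i k + q ^ suc i * altTerm N M (suc i) k)
      ≡⟨ sumTo-+ M (altTerm N M i) _ ⟩
    alt N M i + sumTo M (λ k → q ^ suc i * altTerm N M (suc i) k)
      ≡⟨ cong (alt N M i +_) (sumTo-*ˡ M (q ^ suc i) (altTerm N M (suc i))) ⟩
    alt N M i + q ^ suc i * alt N M (suc i) ∎
    where
    last≡0 : altTerm N (suc M) (suc i) (suc M) ≡ 0ℚ
    last≡0 = trans (cong (λ n → sgn (suc M) * q ^ T (suc M) * (gauss N (suc M) * gauss n (suc i))) (ℕ.n∸n≡0 M))
                   (vanish (sgn (suc M)) (q ^ T (suc M)) (gauss N (suc M)))
      where
      vanish : ∀ s t g → s * t * (g * 0ℚ) ≡ 0ℚ
      vanish = solve-∀ ℚ-ring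
    pascal : ∀ k → k ≤ M → altTerm N (suc M) (suc i) k ≡ altTerm N M i k + q ^ suc i * altTerm N M (suc i) k
    pascal k k≤M rewrite ℕ.+-∸-assoc 1 k≤M =
      distrib (sgn k * q ^ T k) (gauss N k) (gauss (M ∸ k) i) (q ^ suc i) (gauss (M ∸ k) (suc i))
      where
      distrib : ∀ c g a x b → c * (g * (a + x * b)) ≡ c * (g * a) + x * (c * (g * b))
      distrib = solve-∀ ℚ-ring

  alt-zero : ∀ M → alt 0 M 0 ≡ 1ℚ
  alt-zero M = sumTo-only-head M (altTerm 0 M 0) (λ k → vanish (sgn (suc k)) (q ^ T (suc k)) (gauss (M ∸ suc k) 0))
    where
    vanish : ∀ s t g → s * t * (0ℚ * g) ≡ 0ℚ
    vanish = solve-∀ ℚ-ring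

  alt-diag : ∀ N → alt (suc N) (suc N) (suc N) ≡ 1ℚ
  alt-diag N = trans (sumTo-only-head (suc N) (altTerm (suc N) (suc N) (suc N)) tail≡0)
                     (cong (λ g → 1ℚ * 1ℚ * (1ℚ * g)) (gauss-diag (suc N)))
    where
    vanish : ∀ s t g → s * t * (g * 0ℚ) ≡ 0ℚ
    vanish = solve-∀ ℚ-ring
    tail≡0 : ∀ k → altTerm (suc N) (suc N) (suc N) (suc k) ≡ 0ℚ
    tail≡0 k rewrite gauss-zero {N ∸ k} {suc N} (s≤s (ℕ.m∸n≤m N k)) =
      vanish (sgn (suc k)) (q ^ T (suc k)) (gauss (suc N) (suc k))

  module _ (qⁿ≢1 : ∀ n → q ^ suc n ≢ 1ℚ) where

    alt-stepₙ : ∀ N M i → alt (suc N) (suc M) i ≡ alt N (suc M) i - q ^ suc N * alt N M i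
    alt-stepₙ N M i = begin
      alt (suc N) (suc M) i
        ≡⟨ sumTo-head M (altTerm (suc N) (suc M) i) ⟩
      altTerm N (suc M) i 0 + sumTo M (λ k → altTerm (suc N) (suc M) i (suc k))
        ≡⟨ cong (altTerm N (suc M) i 0 +_) (sumTo-cong M pascal) ⟩
      altTerm N (suc M) i 0 + sumTo M (λ k → altTerm N (suc M) i (suc k) + (- q ^ suc N) * altTerm N M i k)
        ≡⟨ cong (altTerm N (suc M) i 0 +_) (sumTo-+ M (λ k → altTerm N (suc M) i (suc k)) _) ⟩
      altTerm N (suc M) i 0 + (sumTo M (λ k → altTerm N (suc M) i (suc k)) + sumTo M (λ k → (- q ^ suc N) * altTerm N M i k))
        ≡⟨ cong (λ t → altTerm N (suc M) i 0 + (sumTo M (λ k → altTerm N (suc M) i (suc k)) + t))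
                (sumTo-*ˡ M (- q ^ suc N) (altTerm N M i)) ⟩
      altTerm N (suc M) i 0 + (sumTo M (λ k → altTerm N (suc M) i (suc k)) + (- q ^ suc N) * alt N M i)
        ≡⟨ regroup (altTerm N (suc M) i 0) _ (q ^ suc N) (alt N M i) ⟩
      (altTerm N (suc M) i 0 + sumTo M (λ k → altTerm N (suc M) i (suc k))) - q ^ suc N * alt N M i
        ≡⟨ cong (_- q ^ suc N * alt N M i) (sumTo-head M (altTerm N (suc M) i)) ⟨
      alt N (suc M) i - q ^ suc N * alt N M i ∎
      where
      regroup : ∀ a b x c → a + (b + (- x) * c) ≡ (a + b) - x * c
      regroup = solve-∀ ℚ-ring
      pascal : ∀ k → altTerm (suc N) (suc M) i (suc k) ≡ altTerm N (suc M) i (suc k) + (- q ^ suc N) * altTerm N M i k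
      pascal k = begin
        (- 1ℚ * sgn k) * q ^ (suc k ℕ.+ T k) * (gauss (suc N) (suc k) * h)
          ≡⟨ cong (λ t → (- 1ℚ * sgn k) * t * (gauss (suc N) (suc k) * h)) (^-distribˡ-+-* q (suc k) (T k)) ⟩
        (- 1ℚ * sgn k) * (q ^ suc k * q ^ T k) * (gauss (suc N) (suc k) * h)
          ≡⟨ pull (sgn k) (q ^ T k) h (q ^ suc k) (gauss (suc N) (suc k)) ⟩
        - (sgn k * q ^ T k * h) * (q ^ suc k * gauss (suc N) (suc k))
          ≡⟨ cong (λ t → - (sgn k * q ^ T k * h) * t) (gauss-pascalʳ-scaled qⁿ≢1 N k) ⟩
        - (sgn k * q ^ T k * h) * (q ^ suc N * gauss N k + q ^ suc k * gauss N (suc k))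
          ≡⟨ push (sgn k) (q ^ T k) h (q ^ suc N) (gauss N k) (q ^ suc k) (gauss N (suc k)) ⟩
        (- 1ℚ * sgn k) * (q ^ suc k * q ^ T k) * (gauss N (suc k) * h) + (- q ^ suc N) * (sgn k * q ^ T k * (gauss N k * h))
          ≡⟨ cong (λ t → (- 1ℚ * sgn k) * t * (gauss N (suc k) * h) + (- q ^ suc N) * altTerm N M i k)
                  (^-distribˡ-+-* q (suc k) (T k)) ⟨
        altTerm N (suc M) i (suc k) + (- q ^ suc N) * altTerm N M i k ∎
        where
        h = gauss (M ∸ k) i
        pull : ∀ s t h x g → (- 1ℚ * s) * (x * t) * (g * h) ≡ - (s * t * h) * (x * g)
        pull = solve-∀ ℚ-ring
        push : ∀ s t h y a x b → - (s * t * h) * (y * a + x * b) ≡ (- 1ℚ * s) * (x * t) * (b * h) + (- y) * (s * t * (a * h))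
        push = solve-∀ ℚ-ring

    -- Induction on N: the Pascal rule in N (alt-stepₙ) settles i ≤ N, and the one in i
    -- (alt-stepᵢ), by induction on M, the new diagonal entry i = N + 1.
    alt-*-fac : ∀ N M i → i ≤ N → N ≤ M → alt N M i * fac i ≡ fac N
    alt-*-fac-below : ∀ N {M i} → i ≤ N → suc N ≤ M → alt (suc N) M i * fac i ≡ fac (suc N)
    alt-top : ∀ N M → suc N ≤ M → alt (suc N) M (suc N) ≡ 1ℚ

    alt-*-fac zero    M zero    _        _    = cong (_* 1ℚ) (alt-zero M)
    alt-*-fac (suc N) M i       i≤1+N    1+N≤M with ℕ.m≤n⇒m<n∨m≡n i≤1+N
    ... | inj₁ (s≤s i≤N) = alt-*-fac-below N i≤N 1+N≤M
    ... | inj₂ refl      = trans (cong (_* fac (suc N)) (alt-top N M 1+N≤M)) (ℚ.*-identityˡ (fac (suc N)))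

    alt-*-fac-below N {suc M} {i} i≤N (s≤s N≤M) = begin
      alt (suc N) (suc M) i * fac i
        ≡⟨ cong (_* fac i) (alt-stepₙ N M i) ⟩
      (alt N (suc M) i - q ^ suc N * alt N M i) * fac i
        ≡⟨ distrib (alt N (suc M) i) (q ^ suc N) (alt N M i) (fac i) ⟩
      alt N (suc M) i * fac i - q ^ suc N * (alt N M i * fac i)
        ≡⟨ cong₂ (λ a b → a - q ^ suc N * b) (alt-*-fac N (suc M) i i≤N (ℕ.m≤n⇒m≤1+n N≤M)) (alt-*-fac N M i i≤N N≤M) ⟩
      fac N - q ^ suc N * fac N
        ≡⟨ factor (fac N) (q ^ suc N) ⟩
      fac (suc N) ∎
      where
      distrib : ∀ a x b p → (a - x * b) * p ≡ a * p - x * (b * p)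
      distrib = solve-∀ ℚ-ring
      factor : ∀ p x → p - x * p ≡ p * (1ℚ - x)
      factor = solve-∀ ℚ-ring

    alt-top N (suc M) (s≤s N≤M) with ℕ.m≤n⇒m<n∨m≡n N≤M
    ... | inj₂ refl = alt-diag N
    ... | inj₁ N<M  = begin
      alt (suc N) (suc M) (suc N)
        ≡⟨ alt-stepᵢ (suc N) M N ⟩
      alt (suc N) M N + q ^ suc N * alt (suc N) M (suc N)
        ≡⟨ cong₂ (λ a b → a + q ^ suc N * b) below (alt-top N M N<M) ⟩
      (1ℚ - q ^ suc N) + q ^ suc N * 1ℚ
        ≡⟨ cancel (q ^ suc N) ⟩
      1ℚ ∎
      where
      below : alt (suc N) M N ≡ 1ℚ - q ^ suc N
      below = *-cancelʳ-≡ (fac N) (fac≢0 qⁿ≢1 N)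
                (trans (alt-*-fac-below N ℕ.≤-refl N<M) (ℚ.*-comm (fac N) (1ℚ - q ^ suc N)))
      cancel : ∀ x → (1ℚ - x) + x * 1ℚ ≡ 1ℚ
      cancel = solve-∀ ℚ-ring

    alt-closed : ∀ {N M i} → i ≤ N → N ≤ M → alt N M i ≡ gauss N i * fac (N ∸ i)
    alt-closed {N} {M} {i} i≤N N≤M = *-cancelʳ-≡ (fac i) (fac≢0 qⁿ≢1 i) (begin
      alt N M i * fac i
        ≡⟨ alt-*-fac N M i i≤N N≤M ⟩
      fac N
        ≡⟨ gauss-*-fac-∸ i≤N ⟨
      gauss N i * (fac i * fac (N ∸ i))
        ≡⟨ reorder (gauss N i) (fac i) (fac (N ∸ i)) ⟩
      gauss N i * fac (N ∸ i) * fac i ∎)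
      where
      reorder : ∀ g a b → g * (a * b) ≡ g * b * a
      reorder = solve-∀ ℚ-ring

module Weights (q : ℚ) where
  open Gaussian q

  -- q^(ij) (q;q)_(L-i) (q;q)_(L-j) / ((q;q)_i (q;q)_j (q;q)_(L-i-j)), cf. W-*-facs.
  W : ℕ → ℕ → ℕ → ℚ
  W L i j = q ^ (i ℕ.* j) * gauss (L ∸ i) j * (gauss (L ∸ j) i * fac (L ∸ j ∸ i))

  W-zero : ∀ {L} i j → L < i ℕ.+ j → W L i j ≡ 0ℚ
  W-zero {L} i j L<i+j with i ≤? L
  ... | no i≰L rewrite gauss-zero {L ∸ j} {i} (ℕ.≤-<-trans (ℕ.m∸n≤m L j) (ℕ.≰⇒> i≰L)) =
    vanish (q ^ (i ℕ.* j)) (gauss (L ∸ i) j) (fac (L ∸ j ∸ i))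
    where
    vanish : ∀ e a f → e * a * (0ℚ * f) ≡ 0ℚ
    vanish = solve-∀ ℚ-ring
  ... | yes i≤L rewrite gauss-zero-∸ i≤L L<i+j =
    vanish (q ^ (i ℕ.* j)) (gauss (L ∸ j) i * fac (L ∸ j ∸ i))
    where
    vanish : ∀ e b → e * 0ℚ * b ≡ 0ℚ
    vanish = solve-∀ ℚ-ring

  W-boundary : ∀ {L} i j → i ℕ.+ j ≡ L → W L i j ≡ q ^ (i ℕ.* j)
  W-boundary i j refl rewrite ℕ.m+n∸m≡n i j | ℕ.m+n∸n≡m i j | ℕ.n∸n≡0 i | gauss-diag i | gauss-diag j =
    unit (q ^ (i ℕ.* j))
    where
    unit : ∀ e → e * 1ℚ * (1ℚ * 1ℚ) ≡ e
    unit = solve-∀ ℚ-ring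

  W-*-facs : ∀ {L} i j r → i ℕ.+ j ℕ.+ r ≡ L → W L i j * (fac i * fac j * fac r) ≡ q ^ (i ℕ.* j) * fac (j ℕ.+ r) * fac (i ℕ.+ r)
  W-*-facs i j r refl rewrite m+n+o∸m≡n+o i j r | m+n+o∸n≡m+o i j r | ℕ.m+n∸m≡n i r = begin
    q ^ (i ℕ.* j) * gauss (j ℕ.+ r) j * (gauss (i ℕ.+ r) i * fac r) * (fac i * fac j * fac r)
      ≡⟨ regroup (q ^ (i ℕ.* j)) (gauss (j ℕ.+ r) j) (gauss (i ℕ.+ r) i) (fac i) (fac j) (fac r) ⟩
    q ^ (i ℕ.* j) * (gauss (j ℕ.+ r) j * (fac j * fac r)) * (gauss (i ℕ.+ r) i * (fac i * fac r))
      ≡⟨ cong₂ (λ a b → q ^ (i ℕ.* j) * a * b) (gauss-*-fac j r) (gauss-*-fac i r) ⟩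
    q ^ (i ℕ.* j) * fac (j ℕ.+ r) * fac (i ℕ.+ r) ∎
    where
    regroup : ∀ e a b p s t → e * a * (b * t) * (p * s * t) ≡ e * (a * (s * t)) * (b * (p * t))
    regroup = solve-∀ ℚ-ring

  W-left-edge : ∀ {L j} → j ≤ L → W L 0 j * fac j ≡ fac L
  W-left-edge {L} {j} j≤L = trans (reorder (gauss L j) (fac (L ∸ j)) (fac j)) (gauss-*-fac-∸ j≤L)
    where
    reorder : ∀ g f p → 1ℚ * g * (1ℚ * f) * p ≡ g * (p * f)
    reorder = solve-∀ ℚ-ring

  W-sym : ∀ L i j → W L i j ≡ W L j i
  W-sym L i j = begin
    q ^ (i ℕ.* j) * gauss (L ∸ i) j * (gauss (L ∸ j) i * fac (L ∸ j ∸ i))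
      ≡⟨ cong₂ (λ e f → q ^ e * gauss (L ∸ i) j * (gauss (L ∸ j) i * fac f)) (ℕ.*-comm i j) (m∸n∸o≡m∸o∸n L j i) ⟩
    q ^ (j ℕ.* i) * gauss (L ∸ i) j * (gauss (L ∸ j) i * fac (L ∸ i ∸ j))
      ≡⟨ swap (q ^ (j ℕ.* i)) (gauss (L ∸ i) j) (gauss (L ∸ j) i) (fac (L ∸ i ∸ j)) ⟩
    q ^ (j ℕ.* i) * gauss (L ∸ j) i * (gauss (L ∸ i) j * fac (L ∸ i ∸ j)) ∎
    where
    swap : ∀ e a b f → e * a * (b * f) ≡ e * b * (a * f)
    swap = solve-∀ ℚ-ring

  -- W_(m-1)(i-1, j-1), read as 0 when an index would be negative.
  shiftedW : ℕ → ℕ → ℕ → ℚ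
  shiftedW m       zero    j       = 0ℚ
  shiftedW m       (suc i) zero    = 0ℚ
  shiftedW zero    (suc i) (suc j) = 0ℚ
  shiftedW (suc m) (suc i) (suc j) = W m i j

  shiftedW-zeroʳ : ∀ m i → shiftedW m i 0 ≡ 0ℚ
  shiftedW-zeroʳ m zero    = refl
  shiftedW-zeroʳ m (suc i) = refl

  module _ (qⁿ≢1 : ∀ n → q ^ suc n ≢ 1ℚ) where

    W-step-left-edge : ∀ m j → W (suc m) 0 j ≡ (1ℚ - q ^ suc m) * W m 0 j + δ j (suc m)
    W-step-left-edge m j with ℕ.<-cmp j (suc m)
    ... | tri< (s≤s j≤m) _ _ rewrite δ-≢ {j} {suc m} (ℕ.<⇒≢ (s≤s j≤m)) = begin
      W (suc m) 0 j
        ≡⟨ *-cancelʳ-≡ (fac j) (fac≢0 qⁿ≢1 j) (begin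
            W (suc m) 0 j * fac j                ≡⟨ W-left-edge (ℕ.m≤n⇒m≤1+n j≤m) ⟩
            fac m * (1ℚ - q ^ suc m)             ≡⟨ cong (_* (1ℚ - q ^ suc m)) (W-left-edge j≤m) ⟨
            W m 0 j * fac j * (1ℚ - q ^ suc m)   ≡⟨ swap (W m 0 j) (fac j) (1ℚ - q ^ suc m) ⟩
            (1ℚ - q ^ suc m) * W m 0 j * fac j   ∎) ⟩
      (1ℚ - q ^ suc m) * W m 0 j
        ≡⟨ ℚ.+-identityʳ _ ⟨
      (1ℚ - q ^ suc m) * W m 0 j + 0ℚ ∎
      where
      swap : ∀ w p x → w * p * x ≡ x * w * p
      swap = solve-∀ ℚ-ring
    ... | tri≈ _ refl _ rewrite W-boundary {suc m} 0 (suc m) refl | W-zero {m} 0 (suc m) (ℕ.n<1+n m) | δ-refl m =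
      corner-only (1ℚ - q ^ suc m)
      where
      corner-only : ∀ x → 1ℚ ≡ x * 0ℚ + 1ℚ
      corner-only = solve-∀ ℚ-ring
    ... | tri> _ _ 1+m<j rewrite W-zero 0 j 1+m<j | W-zero 0 j (ℕ.<-trans (ℕ.n<1+n m) 1+m<j)
                               | δ-≢ {j} {suc m} (ℕ.>⇒≢ 1+m<j) =
      nothing-left (1ℚ - q ^ suc m)
      where
      nothing-left : ∀ x → 0ℚ ≡ x * 0ℚ + 0ℚ
      nothing-left = solve-∀ ℚ-ring

    W-step-boundary : ∀ {m} i j → i ℕ.+ j ≡ m →
      W (suc (suc m)) (suc i) (suc j) ≡ (1ℚ - q ^ suc (suc m)) * W (suc m) (suc i) (suc j) + q ^ suc m * W m i j
    W-step-boundary i j refl = begin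
      W (suc (suc (i ℕ.+ j))) (suc i) (suc j)
        ≡⟨ W-boundary (suc i) (suc j) (cong suc (ℕ.+-suc i j)) ⟩
      q ^ (suc i ℕ.* suc j)
        ≡⟨ cong (q ^_) (exponent i j) ⟩
      q ^ (suc (i ℕ.+ j) ℕ.+ i ℕ.* j)
        ≡⟨ ^-distribˡ-+-* q (suc (i ℕ.+ j)) (i ℕ.* j) ⟩
      q ^ suc (i ℕ.+ j) * q ^ (i ℕ.* j)
        ≡⟨ pad (1ℚ - q ^ suc (suc (i ℕ.+ j))) _ ⟩
      (1ℚ - q ^ suc (suc (i ℕ.+ j))) * 0ℚ + q ^ suc (i ℕ.+ j) * q ^ (i ℕ.* j)
        ≡⟨ cong₂ (λ a b → (1ℚ - q ^ suc (suc (i ℕ.+ j))) * a + q ^ suc (i ℕ.+ j) * b)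
                 (W-zero (suc i) (suc j) (subst (suc (i ℕ.+ j) <_) (sym (cong suc (ℕ.+-suc i j))) ℕ.≤-refl)) (W-boundary i j refl) ⟨
      (1ℚ - q ^ suc (suc (i ℕ.+ j))) * W (suc (i ℕ.+ j)) (suc i) (suc j) + q ^ suc (i ℕ.+ j) * W (i ℕ.+ j) i j ∎
      where
      exponent : ∀ i j → suc i ℕ.* suc j ≡ suc (i ℕ.+ j) ℕ.+ i ℕ.* j
      exponent = ℕ-solve
      pad : ∀ x a → a ≡ x * 0ℚ + a
      pad = solve-∀ ℚ-ring

    -- After multiplying by (q;q)_(i+1) (q;q)_(j+1) (q;q)_(r+1) all three weights are products of
    -- q-factorials (W-*-facs), and the step reduces to (1-yc)(1-xc) = (1-xyc)(1-c) + c(1-x)(1-y).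
    W-step-main : ∀ {m} i j r → i ℕ.+ j ℕ.+ suc r ≡ m →
      W (suc (suc m)) (suc i) (suc j) ≡ (1ℚ - q ^ suc (suc m)) * W (suc m) (suc i) (suc j) + q ^ suc m * W m i j
    W-step-main {m} i j r refl = *-cancelʳ-≡ M M≢0 (begin
      W (suc (suc m)) (suc i) (suc j) * M
        ≡⟨ W-*-facs (suc i) (suc j) (suc r) (level₂ i j r) ⟩
      e * fac (suc j ℕ.+ suc r) * fac (suc i ℕ.+ suc r)
        ≡⟨ cong₂ (λ a b → e * a * b) (fac-+-suc (suc j) r) (fac-+-suc (suc i) r) ⟩
      e * (A * (1ℚ - y * c)) * (B * (1ℚ - x * c))
        ≡⟨ key e A B x y c ⟩
      (1ℚ - x * y * c) * (e * A * B) * (1ℚ - c) + e * c * (A * B) * ((1ℚ - x) * (1ℚ - y))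
        ≡⟨ cong₂ (λ X t → (1ℚ - X) * (e * A * B) * (1ℚ - c) + t * ((1ℚ - x) * (1ℚ - y))) (sym (level-power i j r)) shifted ⟩
      (1ℚ - q ^ suc (suc m)) * (e * A * B) * (1ℚ - c) + q ^ suc m * (W m i j * (fac i * fac j * fac (suc r))) * ((1ℚ - x) * (1ℚ - y))
        ≡⟨ cong (λ a → (1ℚ - q ^ suc (suc m)) * a * (1ℚ - c) + q ^ suc m * (W m i j * (fac i * fac j * fac (suc r))) * ((1ℚ - x) * (1ℚ - y)))
                (sym (W-*-facs (suc i) (suc j) r (level₁ i j r))) ⟩
      (1ℚ - q ^ suc (suc m)) * (W (suc m) (suc i) (suc j) * (fac (suc i) * fac (suc j) * fac r)) * (1ℚ - c)
        + q ^ suc m * (W m i j * (fac i * fac j * fac (suc r))) * ((1ℚ - x) * (1ℚ - y))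
        ≡⟨ collect (1ℚ - q ^ suc (suc m)) (W (suc m) (suc i) (suc j)) (q ^ suc m) (W m i j) (fac i) (fac j) (fac r) x y c ⟩
      ((1ℚ - q ^ suc (suc m)) * W (suc m) (suc i) (suc j) + q ^ suc m * W m i j) * M ∎)
      where
      x = q ^ suc i
      y = q ^ suc j
      c = q ^ suc r
      e = q ^ (suc i ℕ.* suc j)
      A = fac (suc j ℕ.+ r)
      B = fac (suc i ℕ.+ r)
      M = fac (suc i) * fac (suc j) * fac (suc r)
      M≢0 : M ≢ 0ℚ
      M≢0 = *-≢0 (*-≢0 (fac≢0 qⁿ≢1 (suc i)) (fac≢0 qⁿ≢1 (suc j))) (fac≢0 qⁿ≢1 (suc r))
      level₁ : ∀ i j r → suc i ℕ.+ suc j ℕ.+ r ≡ suc (i ℕ.+ j ℕ.+ suc r)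
      level₁ = ℕ-solve
      level₂ : ∀ i j r → suc i ℕ.+ suc j ℕ.+ suc r ≡ suc (suc (i ℕ.+ j ℕ.+ suc r))
      level₂ = ℕ-solve
      level-power : ∀ i j r → q ^ suc (suc (i ℕ.+ j ℕ.+ suc r)) ≡ q ^ suc i * q ^ suc j * q ^ suc r
      level-power i j r = begin
        q ^ suc (suc (i ℕ.+ j ℕ.+ suc r))       ≡⟨ cong (q ^_) (level₂ i j r) ⟨
        q ^ (suc i ℕ.+ suc j ℕ.+ suc r)         ≡⟨ ^-distribˡ-+-* q (suc i ℕ.+ suc j) (suc r) ⟩
        q ^ (suc i ℕ.+ suc j) * q ^ suc r       ≡⟨ cong (_* q ^ suc r) (^-distribˡ-+-* q (suc i) (suc j)) ⟩
        q ^ suc i * q ^ suc j * q ^ suc r       ∎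
      shift-power : ∀ i j r → q ^ suc (i ℕ.+ j ℕ.+ suc r) * q ^ (i ℕ.* j) ≡ q ^ (suc i ℕ.* suc j) * q ^ suc r
      shift-power i j r = begin
        q ^ suc (i ℕ.+ j ℕ.+ suc r) * q ^ (i ℕ.* j)   ≡⟨ ^-distribˡ-+-* q (suc (i ℕ.+ j ℕ.+ suc r)) (i ℕ.* j) ⟨
        q ^ (suc (i ℕ.+ j ℕ.+ suc r) ℕ.+ i ℕ.* j)     ≡⟨ cong (q ^_) (exponent i j r) ⟩
        q ^ (suc i ℕ.* suc j ℕ.+ suc r)               ≡⟨ ^-distribˡ-+-* q (suc i ℕ.* suc j) (suc r) ⟩
        q ^ (suc i ℕ.* suc j) * q ^ suc r             ∎
        where
        exponent : ∀ i j r → suc (i ℕ.+ j ℕ.+ suc r) ℕ.+ i ℕ.* j ≡ suc i ℕ.* suc j ℕ.+ suc r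
        exponent = ℕ-solve
      shifted : e * c * (A * B) ≡ q ^ suc m * (W m i j * (fac i * fac j * fac (suc r)))
      shifted = begin
        e * c * (A * B)
          ≡⟨ cong (_* (A * B)) (shift-power i j r) ⟨
        q ^ suc m * q ^ (i ℕ.* j) * (A * B)
          ≡⟨ ℚ.*-assoc (q ^ suc m) (q ^ (i ℕ.* j)) (A * B) ⟩
        q ^ suc m * (q ^ (i ℕ.* j) * (A * B))
          ≡⟨ cong (q ^ suc m *_) (ℚ.*-assoc (q ^ (i ℕ.* j)) A B) ⟨
        q ^ suc m * (q ^ (i ℕ.* j) * A * B)
          ≡⟨ cong₂ (λ a b → q ^ suc m * (q ^ (i ℕ.* j) * fac a * fac b)) (ℕ.+-suc j r) (ℕ.+-suc i r) ⟨
        q ^ suc m * (q ^ (i ℕ.* j) * fac (j ℕ.+ suc r) * fac (i ℕ.+ suc r))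
          ≡⟨ cong (q ^ suc m *_) (W-*-facs i j (suc r) refl) ⟨
        q ^ suc m * (W m i j * (fac i * fac j * fac (suc r))) ∎
      key : ∀ e A B x y c → e * (A * (1ℚ - y * c)) * (B * (1ℚ - x * c))
                          ≡ (1ℚ - x * y * c) * (e * A * B) * (1ℚ - c) + e * c * (A * B) * ((1ℚ - x) * (1ℚ - y))
      key = solve-∀ ℚ-ring
      collect : ∀ X w Q v Pi Pj Pr x y c →
        X * (w * (Pi * (1ℚ - x) * (Pj * (1ℚ - y)) * Pr)) * (1ℚ - c) + Q * (v * (Pi * Pj * (Pr * (1ℚ - c)))) * ((1ℚ - x) * (1ℚ - y))
        ≡ (X * w + Q * v) * (Pi * (1ℚ - x) * (Pj * (1ℚ - y)) * (Pr * (1ℚ - c)))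
      collect = solve-∀ ℚ-ring

    private
      no-shift : ∀ a y c → a + c ≡ a + y * 0ℚ + c
      no-shift = solve-∀ ℚ-ring
      zeros : ∀ x y → 0ℚ ≡ x * 0ℚ + y * 0ℚ + 0ℚ
      zeros = solve-∀ ℚ-ring

    W-step : ∀ m i j → W (suc m) i j ≡ (1ℚ - q ^ suc m) * W m i j + q ^ m * shiftedW m i j + corner (suc m) i j
    W-step m zero    j    = trans (W-step-left-edge m j) (no-shift ((1ℚ - q ^ suc m) * W m 0 j) (q ^ m) (δ j (suc m)))
    W-step m (suc i) zero = begin
      W (suc m) (suc i) 0
        ≡⟨ W-sym (suc m) (suc i) 0 ⟩
      W (suc m) 0 (suc i)
        ≡⟨ W-step-left-edge m (suc i) ⟩
      (1ℚ - q ^ suc m) * W m 0 (suc i) + δ (suc i) (suc m)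
        ≡⟨ cong (λ w → (1ℚ - q ^ suc m) * w + δ (suc i) (suc m)) (W-sym m 0 (suc i)) ⟩
      (1ℚ - q ^ suc m) * W m (suc i) 0 + δ (suc i) (suc m)
        ≡⟨ no-shift ((1ℚ - q ^ suc m) * W m (suc i) 0) (q ^ m) (δ (suc i) (suc m)) ⟩
      (1ℚ - q ^ suc m) * W m (suc i) 0 + q ^ m * 0ℚ + δ (suc i) (suc m) ∎
    W-step zero (suc i) (suc j)
      rewrite W-zero {1} (suc i) (suc j) (s≤s (ℕ.≤-trans (s≤s z≤n) (ℕ.m≤n+m (suc j) i)))
            | W-zero {0} (suc i) (suc j) (s≤s z≤n) =
      zeros (1ℚ - q ^ 1) (q ^ 0)
    W-step (suc m) (suc i) (suc j) with i ℕ.+ j ≤? m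
    ... | no  i+j≰m = begin
      W (suc (suc m)) (suc i) (suc j)
        ≡⟨ W-zero (suc i) (suc j) (subst (suc (suc m) <_) (sym (cong suc (ℕ.+-suc i j))) (s≤s (s≤s m<i+j))) ⟩
      0ℚ
        ≡⟨ zeros (1ℚ - q ^ suc (suc m)) (q ^ suc m) ⟩
      (1ℚ - q ^ suc (suc m)) * 0ℚ + q ^ suc m * 0ℚ + 0ℚ
        ≡⟨ cong₂ (λ a b → (1ℚ - q ^ suc (suc m)) * a + q ^ suc m * b + 0ℚ)
                 (W-zero (suc i) (suc j) (subst (suc m <_) (sym (cong suc (ℕ.+-suc i j))) (s≤s (s≤s (ℕ.<⇒≤ m<i+j)))))
                 (W-zero i j m<i+j) ⟨
      (1ℚ - q ^ suc (suc m)) * W (suc m) (suc i) (suc j) + q ^ suc m * W m i j + 0ℚ ∎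
      where m<i+j = ℕ.≰⇒> i+j≰m
    ... | yes i+j≤m with ℕ.m≤n⇒∃[o]m+o≡n i+j≤m
    ...   | zero  , i+j+0≡m = trans (W-step-boundary i j (trans (sym (ℕ.+-identityʳ (i ℕ.+ j))) i+j+0≡m)) (sym (ℚ.+-identityʳ _))
    ...   | suc r , i+j+r≡m = trans (W-step-main i j r i+j+r≡m) (sym (ℚ.+-identityʳ _))

module RightHandSide (q : ℚ) (qⁿ≢1 : ∀ n → q ^ suc n ≢ 1ℚ) (z : ℚ) where
  open Gaussian q
  open AlternatingSum q
  open Weights q

  Z : ℕ → ℕ → ℚ
  Z i j = zpow z i j * q ^ T ℕ.∣ i - j ∣

  Z-suc : ∀ i j → Z (suc i) (suc j) ≡ Z i j
  Z-suc i zero    = refl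
  Z-suc i (suc j) = refl

  R : ℕ → ℚ
  R L = sumTo² L (λ i j → Z i j * W L i j)

  R-extend : ∀ m → sumTo² (suc m) (λ i j → Z i j * W m i j) ≡ R m
  R-extend m = sumTo²-drop-last m (λ i j → Z i j * W m i j)
    (λ j → trans (cong (Z (suc m) j *_) (W-zero (suc m) j (ℕ.≤-trans (ℕ.n<1+n m) (ℕ.m≤m+n (suc m) j))))
                 (ℚ.*-zeroʳ (Z (suc m) j)))
    (λ i → trans (cong (Z i (suc m) *_) (W-zero i (suc m) (ℕ.≤-trans (ℕ.n<1+n m) (ℕ.m≤n+m (suc m) i))))
                 (ℚ.*-zeroʳ (Z i (suc m))))

  Rpred : ℕ → ℚ
  Rpred zero    = 0ℚ
  Rpred (suc m) = R m

  shifted-sum : ∀ m → sumTo² (suc m) (λ i j → Z i j * shiftedW m i j) ≡ Rpred m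
  shifted-sum m = trans (sumTo²-drop-first m _ (λ j → ℚ.*-zeroʳ (Z 0 j)) first-column≡0) (shifted m)
    where
    first-column≡0 : ∀ i → Z i 0 * shiftedW m i 0 ≡ 0ℚ
    first-column≡0 i = trans (cong (Z i 0 *_) (shiftedW-zeroʳ m i)) (ℚ.*-zeroʳ (Z i 0))
    shifted : ∀ m → sumTo² m (λ i j → Z (suc i) (suc j) * shiftedW m (suc i) (suc j)) ≡ Rpred m
    shifted zero    = ℚ.*-zeroʳ (Z 1 1)
    shifted (suc m) = trans (sumTo²-cong (suc m) (λ i j → cong (_* W m i j) (Z-suc i j))) (R-extend m)

  corner-sum : ∀ m → sumTo² (suc m) (λ i j → Z i j * corner (suc m) i j) ≡ thetaTerm q z (suc m)
  corner-sum m = begin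
    sumTo² (suc m) (λ i j → Z i j * corner (suc m) i j)
      ≡⟨ sumTo-head m _ ⟩
    sumTo (suc m) (λ j → Z 0 j * δ j (suc m)) + sumTo m (λ i → sumTo (suc m) (λ j → Z (suc i) j * corner (suc m) (suc i) j))
      ≡⟨ cong₂ _+_ (sumTo-δ (suc m) (Z 0)) (sumTo-cong m (λ i → sumTo-head m _)) ⟩
    Z 0 (suc m) + sumTo m (λ i → Z (suc i) 0 * δ i m + sumTo m (λ j → Z (suc i) (suc j) * 0ℚ))
      ≡⟨ cong (Z 0 (suc m) +_) (sumTo-cong m (λ i →
           trans (cong (Z (suc i) 0 * δ i m +_) (sumTo-zero m (λ j _ → ℚ.*-zeroʳ (Z (suc i) (suc j))))) (ℚ.+-identityʳ _))) ⟩
    Z 0 (suc m) + sumTo m (λ i → Z (suc i) 0 * δ i m)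
      ≡⟨ cong (Z 0 (suc m) +_) (sumTo-δ m (λ i → Z (suc i) 0)) ⟩
    zpow z 0 (suc m) * q ^ T (suc m) + z ^ suc m * q ^ T (suc m)
      ≡⟨ collect (zpow z 0 (suc m)) (z ^ suc m) (q ^ T (suc m)) ⟩
    thetaTerm q z (suc m) ∎
    where
    collect : ∀ u v t → u * t + v * t ≡ t * (v + u)
    collect = solve-∀ ℚ-ring

  R-step : ∀ m → R (suc m) ≡ (1ℚ - q ^ suc m) * R m + q ^ m * Rpred m + thetaTerm q z (suc m)
  R-step m = begin
    sumTo² (suc m) (λ i j → Z i j * W (suc m) i j)
      ≡⟨ sumTo²-cong (suc m) (λ i j → trans (cong (Z i j *_) (W-step qⁿ≢1 m i j))
                                           (distrib (Z i j) a (W m i j) b (shiftedW m i j) (corner (suc m) i j))) ⟩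
    sumTo² (suc m) (λ i j → a * (Z i j * W m i j) + b * (Z i j * shiftedW m i j) + Z i j * corner (suc m) i j)
      ≡⟨ sumTo²-+ (suc m) _ _ ⟩
    sumTo² (suc m) (λ i j → a * (Z i j * W m i j) + b * (Z i j * shiftedW m i j))
      + sumTo² (suc m) (λ i j → Z i j * corner (suc m) i j)
      ≡⟨ cong₂ _+_ (sumTo²-+ (suc m) _ _) (corner-sum m) ⟩
    sumTo² (suc m) (λ i j → a * (Z i j * W m i j)) + sumTo² (suc m) (λ i j → b * (Z i j * shiftedW m i j)) + thetaTerm q z (suc m)
      ≡⟨ cong (_+ thetaTerm q z (suc m)) (cong₂ _+_
           (trans (sumTo²-*ˡ (suc m) a _) (cong (a *_) (R-extend m)))
           (trans (sumTo²-*ˡ (suc m) b _) (cong (b *_) (shifted-sum m)))) ⟩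
    a * R m + b * Rpred m + thetaTerm q z (suc m) ∎
    where
    a = 1ℚ - q ^ suc m
    b = q ^ m
    distrib : ∀ ζ a w b s c → ζ * (a * w + b * s + c) ≡ a * (ζ * w) + b * (ζ * s) + ζ * c
    distrib = solve-∀ ℚ-ring

  R-theta : ∀ L → R (suc L) + q ^ suc L * R L ≡ theta q z L
  R-theta zero = begin
    R 1 + q ^ 1 * R 0
      ≡⟨ cong (_+ q ^ 1 * R 0) (R-step 0) ⟩
    (1ℚ - q ^ 1) * R 0 + q ^ 0 * 0ℚ + thetaTerm q z 1 + q ^ 1 * R 0
      ≡⟨ telescope (q ^ 1) (R 0) (q ^ 0) (thetaTerm q z 1) ⟩
    1ℚ + thetaTerm q z 1 ∎
    where
    telescope : ∀ x r y t → (1ℚ - x) * r + y * 0ℚ + t + x * r ≡ r + t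
    telescope = solve-∀ ℚ-ring
  R-theta (suc L) = begin
    R (suc (suc L)) + q ^ suc (suc L) * R (suc L)
      ≡⟨ cong (_+ q ^ suc (suc L) * R (suc L)) (R-step (suc L)) ⟩
    (1ℚ - q ^ suc (suc L)) * R (suc L) + q ^ suc L * R L + thetaTerm q z (suc (suc L)) + q ^ suc (suc L) * R (suc L)
      ≡⟨ telescope (q ^ suc (suc L)) (R (suc L)) (q ^ suc L * R L) (thetaTerm q z (suc (suc L))) ⟩
    (R (suc L) + q ^ suc L * R L) + thetaTerm q z (suc (suc L))
      ≡⟨ cong (_+ thetaTerm q z (suc (suc L))) (R-theta L) ⟩
    theta q z L + thetaTerm q z (suc (suc L))
      ≡⟨ ℚ.+-assoc 1ℚ (sumTo L (λ n → thetaTerm q z (suc n))) (thetaTerm q z (suc (suc L))) ⟩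
    theta q z (suc L) ∎
    where
    telescope : ∀ x r a t → (1ℚ - x) * r + a + t + x * r ≡ (r + a) + t
    telescope = solve-∀ ℚ-ring

  rhsTerm-factor : ∀ L i j k → rhsTerm q z L i j k ≡ Z i j * q ^ (i ℕ.* j) * gauss (L ∸ i) j * altTerm (L ∸ j) L i k
  rhsTerm-factor L i j k
    rewrite qbin≡gauss qⁿ≢1 (L ∸ k) i | qbin≡gauss qⁿ≢1 (L ∸ j) k | qbin≡gauss qⁿ≢1 (L ∸ i) j | T-exponent i j k
          | ^-distribˡ-+-* q (i ℕ.* j ℕ.+ T ℕ.∣ i - j ∣) (T k) | ^-distribˡ-+-* q (i ℕ.* j) (T ℕ.∣ i - j ∣) =
    regroup (sgn k) (zpow z i j) (q ^ (i ℕ.* j)) (q ^ T ℕ.∣ i - j ∣) (q ^ T k)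
            (gauss (L ∸ k) i) (gauss (L ∸ j) k) (gauss (L ∸ i) j)
    where
    regroup : ∀ s u e d t a b c → s * u * (e * d * t) * a * b * c ≡ u * d * e * c * (s * t * (b * a))
    regroup = solve-∀ ℚ-ring

  rhs-inner : ∀ {L i j} → i ≤ L → j ≤ L → sumTo L (rhsTerm q z L i j) ≡ Z i j * W L i j
  rhs-inner {L} {i} {j} i≤L j≤L = begin
    sumTo L (rhsTerm q z L i j)
      ≡⟨ sumTo-cong L (rhsTerm-factor L i j) ⟩
    sumTo L (λ k → K * altTerm (L ∸ j) L i k)
      ≡⟨ sumTo-*ˡ L K (altTerm (L ∸ j) L i) ⟩
    K * alt (L ∸ j) L i
      ≡⟨ evaluate ⟩
    Z i j * W L i j ∎
    where
    K = Z i j * q ^ (i ℕ.* j) * gauss (L ∸ i) j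
    evaluate : K * alt (L ∸ j) L i ≡ Z i j * W L i j
    evaluate with i ≤? L ∸ j
    ... | yes i≤L∸j = trans (cong (K *_) (alt-closed qⁿ≢1 i≤L∸j (ℕ.m∸n≤m L j)))
                            (regroup (Z i j) (q ^ (i ℕ.* j)) (gauss (L ∸ i) j) (gauss (L ∸ j) i * fac (L ∸ j ∸ i)))
      where
      regroup : ∀ ζ e g h → ζ * e * g * h ≡ ζ * (e * g * h)
      regroup = solve-∀ ℚ-ring
    ... | no  i≰L∸j = begin
      Z i j * q ^ (i ℕ.* j) * gauss (L ∸ i) j * alt (L ∸ j) L i
        ≡⟨ cong (λ g → Z i j * q ^ (i ℕ.* j) * g * alt (L ∸ j) L i) (gauss-zero-∸ i≤L L<i+j) ⟩
      Z i j * q ^ (i ℕ.* j) * 0ℚ * alt (L ∸ j) L i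
        ≡⟨ vanish (Z i j) (q ^ (i ℕ.* j)) (alt (L ∸ j) L i) ⟩
      Z i j * 0ℚ
        ≡⟨ cong (Z i j *_) (W-zero i j L<i+j) ⟨
      Z i j * W L i j ∎
      where
      L<i+j : L < i ℕ.+ j
      L<i+j = subst (_< i ℕ.+ j) (ℕ.m∸n+n≡m j≤L) (ℕ.+-monoˡ-< j (ℕ.≰⇒> i≰L∸j))
      vanish : ∀ ζ e a → ζ * e * 0ℚ * a ≡ ζ * 0ℚ
      vanish = solve-∀ ℚ-ring

  rhs≡R : ∀ L → sumTo² L (λ i j → sumTo L (rhsTerm q z L i j)) ≡ R L
  rhs≡R L = sumTo²-cong≤ L (λ i j → rhs-inner)

module LeftHandSide (q z : ℚ) (z≢0 : z ≢ 0ℚ) where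

  zpow-inverse : ∀ n → zpow z 0 n * z ^ n ≡ 1ℚ
  zpow-inverse zero    = refl
  zpow-inverse (suc n) = ⊘-*-cancelʳ 1ℚ (^-≢0 (suc n) z≢0)

  zpow-suc : ∀ n → zpow z 0 (suc n) * z ≡ zpow z 0 n
  zpow-suc n = *-cancelʳ-≡ (z ^ n) (^-≢0 n z≢0) (begin
    zpow z 0 (suc n) * z * z ^ n   ≡⟨ ℚ.*-assoc (zpow z 0 (suc n)) z (z ^ n) ⟩
    zpow z 0 (suc n) * z ^ suc n   ≡⟨ zpow-inverse (suc n) ⟩
    1ℚ                             ≡⟨ zpow-inverse n ⟨
    zpow z 0 n * z ^ n             ∎)

  -- With a = q^(L-n), the two fractions of lhsTerm are (z^(n+1) - (-a)^(n+1)) / (z + a) and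
  -- z^(-n) (1 - (-za)^n) / (1 + za).
  lhsClosed : ℕ → ℕ → ℚ
  lhsClosed L n = (geom z (- q ^ (L ∸ n)) (suc n) + zpow z 0 n * geom 1ℚ (- (z * q ^ (L ∸ n))) n) * q ^ T n

  lhsTerm≡lhsClosed : ∀ L n → q ^ (L ∸ n) + z ≢ 0ℚ → 1ℚ + z * q ^ (L ∸ n) ≢ 0ℚ → lhsTerm q z L n ≡ lhsClosed L n
  lhsTerm≡lhsClosed L n a+z≢0 1+za≢0 = cong₂ (λ s t → (s + t) * q ^ T n) first second
    where
    a = q ^ (L ∸ n)
    u = zpow z 0 n
    aⁿ : ∀ m → a ^ m ≡ q ^ (m ℕ.* (L ∸ n))
    aⁿ m = trans (^-*-assoc q (L ∸ n) m) (cong (q ^_) (ℕ.*-comm (L ∸ n) m))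
    first : (sgn n * q ^ (suc n ℕ.* (L ∸ n)) + z ^ suc n) ⊘ (a + z) ≡ geom z (- a) (suc n)
    first = ⊘-unique a+z≢0 (begin
      geom z (- a) (suc n) * (a + z)               ≡⟨ flip (geom z (- a) (suc n)) a z ⟩
      (z - (- a)) * geom z (- a) (suc n)           ≡⟨ geom-* z (- a) (suc n) ⟩
      z ^ suc n - (- a) ^ suc n                    ≡⟨ cong (λ t → z ^ suc n - t) (neg-^ a (suc n)) ⟩
      z ^ suc n - (- 1ℚ * sgn n) * a ^ suc n       ≡⟨ resign (z ^ suc n) (sgn n) (a ^ suc n) ⟩
      sgn n * a ^ suc n + z ^ suc n                ≡⟨ cong (λ t → sgn n * t + z ^ suc n) (aⁿ (suc n)) ⟩
      sgn n * q ^ (suc n ℕ.* (L ∸ n)) + z ^ suc n  ∎)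
      where
      flip : ∀ G a z → G * (a + z) ≡ (z - (- a)) * G
      flip = solve-∀ ℚ-ring
      resign : ∀ Z s A → Z - (- 1ℚ * s) * A ≡ s * A + Z
      resign = solve-∀ ℚ-ring
    second : (sgn (suc n) * q ^ (n ℕ.* (L ∸ n)) + u) ⊘ (1ℚ + z * a) ≡ u * geom 1ℚ (- (z * a)) n
    second = ⊘-unique 1+za≢0 (begin
      u * geom 1ℚ (- (z * a)) n * (1ℚ + z * a)
        ≡⟨ flip u (geom 1ℚ (- (z * a)) n) (z * a) ⟩
      u * ((1ℚ - (- (z * a))) * geom 1ℚ (- (z * a)) n)
        ≡⟨ cong (u *_) (geom-* 1ℚ (- (z * a)) n) ⟩
      u * (1ℚ ^ n - (- (z * a)) ^ n)
        ≡⟨ cong₂ (λ s t → u * (s - t)) (1^n≡1 n) (trans (neg-^ (z * a) n) (cong (sgn n *_) (^-distribʳ-* z a n))) ⟩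
      u * (1ℚ - sgn n * (z ^ n * a ^ n))
        ≡⟨ expand u (sgn n) (z ^ n) (a ^ n) ⟩
      (- 1ℚ * sgn n) * a ^ n * (u * z ^ n) + u
        ≡⟨ cong₂ (λ s t → (- 1ℚ * sgn n) * s * t + u) (aⁿ n) (zpow-inverse n) ⟩
      sgn (suc n) * q ^ (n ℕ.* (L ∸ n)) * 1ℚ + u
        ≡⟨ cong (_+ u) (ℚ.*-identityʳ (sgn (suc n) * q ^ (n ℕ.* (L ∸ n)))) ⟩
      sgn (suc n) * q ^ (n ℕ.* (L ∸ n)) + u ∎)
      where
      flip : ∀ u G w → u * G * (1ℚ + w) ≡ u * ((1ℚ - (- w)) * G)
      flip = solve-∀ ℚ-ring
      expand : ∀ u s Z A → u * (1ℚ - s * (Z * A)) ≡ (- 1ℚ * s) * A * (u * Z) + u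
      expand = solve-∀ ℚ-ring

  lhsClosed-step : ∀ L n → n ≤ L → lhsClosed (suc L) (suc n) ≡ thetaTerm q z (suc n) + (- q ^ suc L) * lhsClosed L n
  lhsClosed-step L n n≤L = begin
    (z ^ suc n + (- a) * G + u′ * (1ℚ ^ n + (- (z * a)) * H)) * q ^ (suc n ℕ.+ T n)
      ≡⟨ cong₂ (λ s t → (z ^ suc n + (- a) * G + u′ * (s + (- (z * a)) * H)) * t)
               (1^n≡1 n) (^-distribˡ-+-* q (suc n) (T n)) ⟩
    (z ^ suc n + (- a) * G + u′ * (1ℚ + (- (z * a)) * H)) * (p * t)
      ≡⟨ regroup (z ^ suc n) a G u′ z H p t ⟩
    p * t * (z ^ suc n + u′) + (- (p * a)) * ((G + u′ * z * H) * t)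
      ≡⟨ cong₂ (λ s r → s * (z ^ suc n + u′) + (- r) * ((G + u′ * z * H) * t))
               (sym (^-distribˡ-+-* q (suc n) (T n))) p*a≡qᴸ⁺¹ ⟩
    thetaTerm q z (suc n) + (- q ^ suc L) * ((G + u′ * z * H) * t)
      ≡⟨ cong (λ v → thetaTerm q z (suc n) + (- q ^ suc L) * ((G + v * H) * t)) (zpow-suc n) ⟩
    thetaTerm q z (suc n) + (- q ^ suc L) * lhsClosed L n ∎
    where
    a  = q ^ (L ∸ n)
    G  = geom z (- a) (suc n)
    H  = geom 1ℚ (- (z * a)) n
    u′ = zpow z 0 (suc n)
    p  = q ^ suc n
    t  = q ^ T n
    p*a≡qᴸ⁺¹ : p * a ≡ q ^ suc L
    p*a≡qᴸ⁺¹ = trans (sym (^-distribˡ-+-* q (suc n) (L ∸ n))) (cong (q ^_) (cong suc (ℕ.m+[n∸m]≡n n≤L)))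
    regroup : ∀ Zn a G u′ z H p t → (Zn + (- a) * G + u′ * (1ℚ + (- (z * a)) * H)) * (p * t)
                                  ≡ p * t * (Zn + u′) + (- (p * a)) * ((G + u′ * z * H) * t)
    regroup = solve-∀ ℚ-ring

  lhsSum : ℕ → ℚ
  lhsSum L = sumTo L (lhsClosed L)

  lhs-theta : ∀ L → lhsSum (suc L) + q ^ suc L * lhsSum L ≡ theta q z L
  lhs-theta L = begin
    lhsSum (suc L) + q ^ suc L * lhsSum L
      ≡⟨ cong (_+ q ^ suc L * lhsSum L) (sumTo-head L (lhsClosed (suc L))) ⟩
    lhsClosed (suc L) 0 + sumTo L (λ n → lhsClosed (suc L) (suc n)) + q ^ suc L * lhsSum L
      ≡⟨ cong₂ (λ s t → s + t + q ^ suc L * lhsSum L) (first-term (q ^ suc L)) tail ⟩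
    1ℚ + (sumTo L (λ n → thetaTerm q z (suc n)) + (- q ^ suc L) * lhsSum L) + q ^ suc L * lhsSum L
      ≡⟨ cancel (sumTo L (λ n → thetaTerm q z (suc n))) (q ^ suc L) (lhsSum L) ⟩
    theta q z L ∎
    where
    first-term : ∀ a → (1ℚ + (- a) * 0ℚ + 1ℚ * 0ℚ) * 1ℚ ≡ 1ℚ
    first-term = solve-∀ ℚ-ring
    tail : sumTo L (λ n → lhsClosed (suc L) (suc n)) ≡ sumTo L (λ n → thetaTerm q z (suc n)) + (- q ^ suc L) * lhsSum L
    tail = begin
      sumTo L (λ n → lhsClosed (suc L) (suc n))
        ≡⟨ sumTo-cong≤ L (lhsClosed-step L) ⟩
      sumTo L (λ n → thetaTerm q z (suc n) + (- q ^ suc L) * lhsClosed L n)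
        ≡⟨ sumTo-+ L _ _ ⟩
      sumTo L (λ n → thetaTerm q z (suc n)) + sumTo L (λ n → (- q ^ suc L) * lhsClosed L n)
        ≡⟨ cong (sumTo L (λ n → thetaTerm q z (suc n)) +_) (sumTo-*ˡ L (- q ^ suc L) (lhsClosed L)) ⟩
      sumTo L (λ n → thetaTerm q z (suc n)) + (- q ^ suc L) * lhsSum L ∎
    cancel : ∀ S x F → 1ℚ + (S + (- x) * F) + x * F ≡ 1ℚ + S
    cancel = solve-∀ ℚ-ring

mainTheorem4 : (L : ℕ) (q z : ℚ)
    → q ≢ 1ℚ → q ≢ - 1ℚ → z ≢ 0ℚ
    → (∀ n → n ≤ L → q ^ (L ∸ n) + z ≢ 0ℚ)
    → (∀ n → n ≤ L → 1ℚ + z * q ^ (L ∸ n) ≢ 0ℚ)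
    → sumTo L (lhsTerm q z L)
      ≡ sumTo L (λ i → sumTo L (λ j → sumTo L (λ k → rhsTerm q z L i j k)))
mainTheorem4 L q z q≢1 q≢-1 z≢0 a+z≢0 1+za≢0 = begin
  sumTo L (lhsTerm q z L)
    ≡⟨ sumTo-cong≤ L (λ n n≤L → lhsTerm≡lhsClosed L n (a+z≢0 n n≤L) (1+za≢0 n n≤L)) ⟩
  lhsSum L
    ≡⟨ first-order-unique (λ n → q ^ suc n) {lhsSum} {R} refl (λ n → trans (lhs-theta n) (sym (R-theta n))) L ⟩
  R L
    ≡⟨ rhs≡R L ⟨
  sumTo² L (λ i j → sumTo L (rhsTerm q z L i j)) ∎
  where
  open LeftHandSide q z z≢0
  open RightHandSide q (^-suc≢1 q≢1 q≢-1) z
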